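{- (1) The set of terms of $\mathcal{V}(1,2)$ is $\{2\}\cup\{1,3,5,7,\dots\}$, i.e. $\{2\}$ together with all positive odd integers. (2) The set of terms of $\mathcal{V}(1,3)$ is $\{4\}\cup\{1,3,5,7,\dots\}$, i.e. $\{4\}$ together with all positive odd integers.
   Context: For positive integers $a<b$, the sequence $\mathcal{V}(a,b)=(a_m)_{m\geqslant 1}$ is defined greedily by $a_1=a$, $a_2=b$, and, for $m\geqslant 2$, $a_{m+1}$ is the smallest integer larger than $a_m$ that can be written as $a_i+a_j$ with $i\leqslant j\leqslant m$ (the two earlier terms not necessarily distinct) in exactly one way (representations are unordered pairs). -}

module Defs where

open import Data.Nat using (ℕ; zero; suc; _+_; _*_; _<_; _≤_; _≟_)
open import Data.List using (List; concatMap; map; upTo; filter; length)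
open import Data.Product using (_×_; _,_; proj₁; proj₂; ∃-syntax)
open import Data.Sum using (_⊎_)
open import Relation.Nullary using (¬_)
open import Relation.Binary.PropositionalEquality using (_≡_)
open import Function.Bundles using (_⇔_)

-- Sequences are 0-indexed here: f 0 = a_1, f 1 = a_2, …, f m = a_(m+1).

pairs : ℕ → List (ℕ × ℕ)
pairs m = concatMap (λ j → map (λ i → (i , j)) (upTo (suc j))) (upTo (suc m))

reps : (ℕ → ℕ) → ℕ → ℕ → ℕ
reps f m x = length (filter (λ p → f (proj₁ p) + f (proj₂ p) ≟ x) (pairs m))

-- f is the greedy sequence V(a,b): first two terms a, b; for m ≥ 1 (i.e. once
-- at least two terms are known) the next term f (suc m) is the smallest integer
-- larger than f m having exactly one representation from f 0 … f m.
IsV : ℕ → ℕ → (ℕ → ℕ) → Set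
IsV a b f =
  f 0 ≡ a × f 1 ≡ b ×
  (∀ m → 1 ≤ m →
     f m < f (suc m) ×
     reps f m (f (suc m)) ≡ 1 ×
     (∀ x → f m < x → x < f (suc m) → ¬ (reps f m x ≡ 1)))

PosOdd : ℕ → Set
PosOdd n = ∃[ k ] n ≡ suc (2 * k)

TermsAre : (ℕ → ℕ) → ℕ → Set
TermsAre f c = ∀ n → (∃[ m ] f m ≡ n) ⇔ (n ≡ c ⊎ PosOdd n)

-- The sequences in question contain exactly one even term c (c = 2, resp. c = 4) and are
-- increasing.  A sum of two terms is odd only if exactly one summand is c, so an odd x > 2c
-- has the single representation c + (x - c) once x - c is a term; an even x = 2k lying
-- between consecutive odd terms has the two representations 1 + (2k - 1) = 3 + (2k - 3).
-- Hence the explicit sequences below satisfy the greedy rule, and since that rule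
-- determines each term from the previous ones, they are the only such sequences.
module Submission where

open import Defs
open import Data.Nat using (ℕ; zero; suc; _+_; _*_; _<_; _≤_; _≟_; z≤n; s≤s)
open import Data.Nat.Properties
open import Data.List using (List; []; _∷_; map; upTo; filter; length)
open import Data.List.Membership.Propositional using (_∈_; find; lose)
open import Data.List.Membership.Propositional.Properties
  using (∈-concatMap⁺; ∈-concatMap⁻; ∈-map⁺; ∈-map⁻; ∈-upTo⁺; ∈-upTo⁻; ∈-filter⁺; ∈-filter⁻)
open import Data.List.Properties using (filter-accept; filter-reject)
open import Data.List.Relation.Unary.Any using (here; there)
open import Data.List.Relation.Unary.All as All using (All; []; _∷_)
import Data.List.Relation.Unary.All.Properties as All
open import Data.List.Relation.Unary.AllPairs as AllPairs using (_∷_)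
import Data.List.Relation.Unary.AllPairs.Properties as AllPairs
open import Data.List.Relation.Unary.Unique.Propositional using (Unique)
import Data.List.Relation.Unary.Unique.Propositional.Properties as Unique
open import Data.List.Relation.Binary.Disjoint.Propositional using (Disjoint)
open import Data.Nat.Tactic.RingSolver using (solve-∀)
open import Data.Product using (_×_; _,_; proj₁; proj₂; ∃-syntax)
open import Data.Empty using (⊥-elim)
open import Data.Sum using (_⊎_; inj₁; inj₂)
open import Function using (_∘_; id)
open import Function.Bundles using (_⇔_; mk⇔; Equivalence)
open import Relation.Binary using (tri<; tri≈; tri>)
open import Relation.Nullary using (¬_; yes; no)
open import Relation.Unary using (Decidable)
open import Relation.Binary.PropositionalEquality

module _ {A : Set} where

  Unique-constant⇒length≡1 : ∀ {x : A} {xs} → Unique xs → x ∈ xs → (∀ {y} → y ∈ xs → y ≡ x) →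
                             length xs ≡ 1
  Unique-constant⇒length≡1 {xs = _ ∷ []} _ _ _ = refl
  Unique-constant⇒length≡1 {xs = _ ∷ _ ∷ _} ((y≢z ∷ _) ∷ _) _ all≡x =
    ⊥-elim (y≢z (trans (all≡x (here refl)) (sym (all≡x (there (here refl))))))

  distinct-∈⇒2≤length : ∀ {x y : A} {xs} → x ∈ xs → y ∈ xs → x ≢ y → 2 ≤ length xs
  distinct-∈⇒2≤length (here refl) (here refl) x≢y = ⊥-elim (x≢y refl)
  distinct-∈⇒2≤length (here _) (there (here _)) _ = s≤s (s≤s z≤n)
  distinct-∈⇒2≤length (here _) (there (there _)) _ = s≤s (s≤s z≤n)
  distinct-∈⇒2≤length (there (here _)) (here _) _ = s≤s (s≤s z≤n)
  distinct-∈⇒2≤length (there (there _)) (here _) _ = s≤s (s≤s z≤n)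
  distinct-∈⇒2≤length (there x∈xs) (there y∈xs) x≢y = m≤n⇒m≤1+n (distinct-∈⇒2≤length x∈xs y∈xs x≢y)

  filter-cong : ∀ {P Q : A → Set} (P? : Decidable P) (Q? : Decidable Q) {xs} →
                All (λ x → P x ⇔ Q x) xs → filter P? xs ≡ filter Q? xs
  filter-cong P? Q? [] = refl
  filter-cong P? Q? {x ∷ _} (P⇔Q ∷ rest) with P? x
  ... | yes px = trans (cong (x ∷_) (filter-cong P? Q? rest))
                       (sym (filter-accept Q? (Equivalence.to P⇔Q px)))
  ... | no ¬px = trans (filter-cong P? Q? rest)
                       (sym (filter-reject Q? (¬px ∘ Equivalence.from P⇔Q)))

column : ℕ → List (ℕ × ℕ)
column j = map (λ i → (i , j)) (upTo (suc j))

∈-pairs⁻ : ∀ {m i j} → (i , j) ∈ pairs m → i ≤ j × j ≤ m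
∈-pairs⁻ {m} ij∈
  with j , j∈ , ij∈col ← find (∈-concatMap⁻ column {xs = upTo (suc m)} ij∈)
  with i , i∈ , refl ← ∈-map⁻ _ ij∈col
  = ≤-pred (∈-upTo⁻ i∈) , ≤-pred (∈-upTo⁻ j∈)

∈-pairs⁺ : ∀ {m i j} → i ≤ j → j ≤ m → (i , j) ∈ pairs m
∈-pairs⁺ i≤j j≤m = ∈-concatMap⁺ column (lose (∈-upTo⁺ (s≤s j≤m)) (∈-map⁺ _ (∈-upTo⁺ (s≤s i≤j))))

pairs-unique : ∀ m → Unique (pairs m)
pairs-unique m =
  Unique.concat⁺ (All.map⁺ (All.universal column-unique _))
                 (AllPairs.map⁺ (AllPairs.map columns-disjoint (Unique.upTo⁺ (suc m))))
  where
  column-unique : ∀ j → Unique (column j)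
  column-unique j = Unique.map⁺ (cong proj₁) (Unique.upTo⁺ (suc j))
  columns-disjoint : ∀ {j k} → j ≢ k → Disjoint (column j) (column k)
  columns-disjoint j≢k (p , q) with _ , _ , refl ← ∈-map⁻ _ p | _ , _ , refl ← ∈-map⁻ _ q = j≢k refl

sumsTo? : (f : ℕ → ℕ) (x : ℕ) → Decidable (λ (p : ℕ × ℕ) → f (proj₁ p) + f (proj₂ p) ≡ x)
sumsTo? f x p = f (proj₁ p) + f (proj₂ p) ≟ x

Represents : (ℕ → ℕ) → ℕ → ℕ → ℕ × ℕ → Set
Represents f m x (i , j) = i ≤ j × j ≤ m × f i + f j ≡ x

module _ {f : ℕ → ℕ} {m x : ℕ} where

  private
    counted : List (ℕ × ℕ)
    counted = filter (sumsTo? f x) (pairs m)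

    counted⁺ : ∀ {p} → Represents f m x p → p ∈ counted
    counted⁺ (i≤j , j≤m , sum) = ∈-filter⁺ (sumsTo? f x) (∈-pairs⁺ i≤j j≤m) sum

    counted⁻ : ∀ {p} → p ∈ counted → Represents f m x p
    counted⁻ p∈
      with p∈pairs , sum ← ∈-filter⁻ (sumsTo? f x) p∈
      with i≤j , j≤m ← ∈-pairs⁻ p∈pairs
      = i≤j , j≤m , sum

  reps≡1 : ∀ {p} → Represents f m x p → (∀ {q} → Represents f m x q → q ≡ p) → reps f m x ≡ 1
  reps≡1 rep only =
    Unique-constant⇒length≡1 (Unique.filter⁺ (sumsTo? f x) (pairs-unique m)) (counted⁺ rep) (only ∘ counted⁻)

  reps≢1 : ∀ {p q} → Represents f m x p → Represents f m x q → p ≢ q → reps f m x ≢ 1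
  reps≢1 rep rep′ p≢q = >⇒≢ (distinct-∈⇒2≤length (counted⁺ rep) (counted⁺ rep′) p≢q)

reps-cong : ∀ {f g m} x → (∀ {i} → i ≤ m → f i ≡ g i) → reps f m x ≡ reps g m x
reps-cong {f} {g} {m} x f≗g =
  cong length (filter-cong (sumsTo? f x) (sumsTo? g x) (All.tabulate same-sum))
  where
  same-sum : ∀ {p} → p ∈ pairs m → (f (proj₁ p) + f (proj₂ p) ≡ x) ⇔ (g (proj₁ p) + g (proj₂ p) ≡ x)
  same-sum p∈ with i≤j , j≤m ← ∈-pairs⁻ p∈
    rewrite f≗g (≤-trans i≤j j≤m) | f≗g j≤m = mk⇔ id id

IsNextTerm : (ℕ → ℕ) → ℕ → ℕ → Set
IsNextTerm f m y = f m < y × reps f m y ≡ 1 × (∀ x → f m < x → x < y → ¬ (reps f m x ≡ 1))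

IsNextTerm-unique : ∀ {f m y y′} → IsNextTerm f m y → IsNextTerm f m y′ → y ≡ y′
IsNextTerm-unique {y = y} {y′} (fm<y , one , least) (fm<y′ , one′ , least′) with <-cmp y y′
... | tri< y<y′ _ _ = ⊥-elim (least′ y fm<y y<y′ one)
... | tri≈ _ y≡y′ _ = y≡y′
... | tri> _ _ y′<y = ⊥-elim (least y′ fm<y′ y′<y one′)

IsNextTerm-cong : ∀ {f g m y} → (∀ {i} → i ≤ m → f i ≡ g i) → IsNextTerm g m y → IsNextTerm f m y
IsNextTerm-cong {f} {g} {m} {y} f≗g (gm<y , one , least) =
  subst (_< y) (sym fm≡gm) gm<y ,
  trans (reps-cong y f≗g) one ,
  λ x fm<x x<y → least x (subst (_< x) fm≡gm fm<x) x<y ∘ trans (sym (reps-cong x f≗g))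
  where
  fm≡gm : f m ≡ g m
  fm≡gm = f≗g ≤-refl

module _ {a b : ℕ} {f g : ℕ → ℕ} (vf : IsV a b f) (vg : IsV a b g) where

  IsV-agree : ∀ n {i} → i ≤ n → f i ≡ g i
  IsV-agree zero z≤n = trans (proj₁ vf) (sym (proj₁ vg))
  IsV-agree (suc n) i≤1+n with m≤n⇒m<n∨m≡n i≤1+n
  ... | inj₁ i<1+n = IsV-agree n (≤-pred i<1+n)
  ... | inj₂ refl = next-agrees n
    where
    next-agrees : ∀ n → f (suc n) ≡ g (suc n)
    next-agrees zero = trans (proj₁ (proj₂ vf)) (sym (proj₁ (proj₂ vg)))
    next-agrees n@(suc _) = IsNextTerm-unique {f} {n} (proj₂ (proj₂ vf) n (s≤s z≤n))
      (IsNextTerm-cong {f} {g} (IsV-agree n) (proj₂ (proj₂ vg) n (s≤s z≤n)))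

  IsV-unique : ∀ n → f n ≡ g n
  IsV-unique n = IsV-agree n ≤-refl

TermsAre-cong : ∀ {f g c} → (∀ n → f n ≡ g n) → TermsAre g c → TermsAre f c
TermsAre-cong {f} {g} f≗g terms n =
  mk⇔ (λ (m , fm≡n) → Equivalence.to (terms n) (m , trans (sym (f≗g m)) fm≡n))
      (λ n∈ → let m , gm≡n = Equivalence.from (terms n) n∈ in m , trans (f≗g m) gm≡n)

odd : ℕ → ℕ
odd k = suc (2 * k)

odd-suc : ∀ k → odd (suc k) ≡ 2 + odd k
odd-suc k = cong suc (*-suc 2 k)

-- Stated with odd unfolded, since the ring solver cannot see through odd.
odd+odd : ∀ p q → suc (2 * p) + suc (2 * q) ≡ 2 * suc (p + q)
odd+odd = solve-∀

odd<odd-suc : ∀ k → odd k < odd (suc k)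
odd<odd-suc k = subst (odd k <_) (sym (odd-suc k)) (m<n⇒m<1+n (n<1+n (odd k)))

between-odd : ∀ {k x} → odd k < x → x < odd (suc k) → x ≡ suc (odd k)
between-odd {k} {x} k<x x<k′ = ≤-antisym (≤-pred (subst (x <_) (odd-suc k) x<k′)) k<x

double<odd : ∀ {n k} → n ≤ k → 2 * n < odd k
double<odd n≤k = s≤s (*-monoʳ-≤ 2 n≤k)

PosOdd+PosOdd : ∀ {a b} → PosOdd a → PosOdd b → ¬ PosOdd (a + b)
PosOdd+PosOdd (p , refl) (q , refl) (r , a+b≡odd) =
  even≢odd (suc (p + q)) r (trans (sym (odd+odd p q)) a+b≡odd)

StrictlyIncreasing : (ℕ → ℕ) → Set
StrictlyIncreasing f = ∀ {i j} → i < j → f i < f j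

successor-increasing : ∀ {f} → (∀ i → f i < f (suc i)) → StrictlyIncreasing f
successor-increasing {f} step {i} {suc j} i<1+j with m≤n⇒m<n∨m≡n (≤-pred i<1+j)
... | inj₁ i<j = <-trans (successor-increasing step i<j) (step j)
... | inj₂ refl = step i

StrictlyIncreasing⇒injective : ∀ {f} → StrictlyIncreasing f → ∀ {i j} → f i ≡ f j → i ≡ j
StrictlyIncreasing⇒injective f-inc {i} {j} fi≡fj with <-cmp i j
... | tri< i<j _ _ = ⊥-elim (<⇒≢ (f-inc i<j) fi≡fj)
... | tri≈ _ i≡j _ = i≡j
... | tri> _ _ j<i = ⊥-elim (>⇒≢ (f-inc j<i) fi≡fj)

module _ {f : ℕ → ℕ} (f-inc : StrictlyIncreasing f)
         {e : ℕ} (odd-elsewhere : ∀ {i} → i ≢ e → PosOdd (f i)) where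

  reps≡1-through-even : ∀ {m x b} → PosOdd x → f e + f e < x → Represents f m x (e , b) →
                        reps f m x ≡ 1
  reps≡1-through-even {m} {x} {b} odd-x 2fe<x rep@(_ , _ , fe+fb≡x) = reps≡1 {f} rep only
    where
    only : ∀ {q} → Represents f m x q → q ≡ (e , b)
    only {i , j} (i≤j , _ , fi+fj≡x) with i ≟ e | j ≟ e
    ... | yes refl | _ = cong (e ,_) (StrictlyIncreasing⇒injective f-inc
                                        (+-cancelˡ-≡ (f e) _ _ (trans fi+fj≡x (sym fe+fb≡x))))
    ... | no i≢e | yes refl =
      ⊥-elim (<⇒≢ (<-trans (+-monoˡ-< (f e) (f-inc (≤∧≢⇒< i≤j i≢e))) 2fe<x) fi+fj≡x)
    ... | no i≢e | no j≢e =
      ⊥-elim (PosOdd+PosOdd (odd-elsewhere i≢e) (odd-elsewhere j≢e) (subst PosOdd (sym fi+fj≡x) odd-x))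

v₁₂ : ℕ → ℕ
v₁₂ 0 = 1
v₁₂ 1 = 2
v₁₂ (suc (suc k)) = odd (suc k)

v₁₂-increasing : StrictlyIncreasing v₁₂
v₁₂-increasing = successor-increasing step
  where
  step : ∀ i → v₁₂ i < v₁₂ (suc i)
  step 0 = s≤s (s≤s z≤n)
  step 1 = s≤s (s≤s (s≤s z≤n))
  step (suc (suc k)) = odd<odd-suc (suc k)

v₁₂-odd : ∀ {i} → i ≢ 1 → PosOdd (v₁₂ i)
v₁₂-odd {0} _ = 0 , refl
v₁₂-odd {1} 1≢1 = ⊥-elim (1≢1 refl)
v₁₂-odd {suc (suc k)} _ = suc k , refl

v₁₂-IsV : IsV 1 2 v₁₂
v₁₂-IsV = refl , refl , next
  where
  next : ∀ m → 1 ≤ m → IsNextTerm v₁₂ m (v₁₂ (suc m))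
  next 1 _ = s≤s (s≤s (s≤s z≤n)) , refl , λ x 2<x x<3 → ⊥-elim (<⇒≱ 2<x (≤-pred x<3))
  next 2 _ = s≤s (s≤s (s≤s (s≤s z≤n))) , refl , four
    where
    -- 4 = 1 + 3 = 2 + 2, and reps evaluates to 2.
    four : ∀ x → 3 < x → x < 5 → reps v₁₂ 2 x ≢ 1
    four x 3<x x<5 rewrite between-odd {1} 3<x x<5 = λ ()
  next (suc n@(suc (suc k))) _ = odd<odd-suc n , odd-next , even-between
    where
    odd-next : reps v₁₂ (suc n) (odd (suc n)) ≡ 1
    odd-next = reps≡1-through-even v₁₂-increasing v₁₂-odd (suc n , refl)
                 (double<odd (m≤m+n 2 (suc k))) (s≤s z≤n , ≤-refl , sym (odd-suc n))
    even-between : ∀ x → odd n < x → x < odd (suc n) → reps v₁₂ (suc n) x ≢ 1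
    even-between x n<x x<n′ rewrite between-odd {n} n<x x<n′ =
      reps≢1 {v₁₂} {p = 0 , suc n} {q = 2 , n} (z≤n , ≤-refl , refl)
        (s≤s (s≤s z≤n) , n≤1+n n , sym (cong suc (odd-suc (suc k)))) λ ()

v₁₃ : ℕ → ℕ
v₁₃ 0 = 1
v₁₃ 1 = 3
v₁₃ 2 = 4
v₁₃ (suc (suc (suc k))) = odd (suc (suc k))

v₁₃-increasing : StrictlyIncreasing v₁₃
v₁₃-increasing = successor-increasing step
  where
  step : ∀ i → v₁₃ i < v₁₃ (suc i)
  step 0 = s≤s (s≤s z≤n)
  step 1 = s≤s (s≤s (s≤s (s≤s z≤n)))
  step 2 = s≤s (s≤s (s≤s (s≤s (s≤s z≤n))))
  step (suc (suc (suc k))) = odd<odd-suc (suc (suc k))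

v₁₃-odd : ∀ {i} → i ≢ 2 → PosOdd (v₁₃ i)
v₁₃-odd {0} _ = 0 , refl
v₁₃-odd {1} _ = 1 , refl
v₁₃-odd {2} 2≢2 = ⊥-elim (2≢2 refl)
v₁₃-odd {suc (suc (suc k))} _ = suc (suc k) , refl

v₁₃-IsV : IsV 1 3 v₁₃
v₁₃-IsV = refl , refl , next
  where
  next : ∀ m → 1 ≤ m → IsNextTerm v₁₃ m (v₁₃ (suc m))
  next 1 _ = s≤s (s≤s (s≤s (s≤s z≤n))) , refl , λ x 3<x x<4 → ⊥-elim (<⇒≱ 3<x (≤-pred x<4))
  next 2 _ = s≤s (s≤s (s≤s (s≤s (s≤s z≤n)))) , refl , λ x 4<x x<5 → ⊥-elim (<⇒≱ 4<x (≤-pred x<5))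
  next 3 _ = s≤s (s≤s (s≤s (s≤s (s≤s (s≤s z≤n))))) , refl , six
    where
    -- 6 = 1 + 5 = 3 + 3, and reps evaluates to 2.
    six : ∀ x → 5 < x → x < 7 → reps v₁₃ 3 x ≢ 1
    six x 5<x x<7 rewrite between-odd {2} 5<x x<7 = λ ()
  next (suc n@(suc (suc (suc k)))) _ = odd<odd-suc n , odd-next , even-between
    where
    odd-next : reps v₁₃ (suc n) (odd (suc n)) ≡ 1
    odd-next = reps≡1-through-even v₁₃-increasing v₁₃-odd (suc n , refl) (double<odd (m≤m+n 4 k))
                 (s≤s (s≤s z≤n) , n≤1+n n ,
                  sym (trans (odd-suc n) (cong (2 +_) (odd-suc (suc (suc k))))))
    even-between : ∀ x → odd n < x → x < odd (suc n) → reps v₁₃ (suc n) x ≢ 1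
    even-between x n<x x<n′ rewrite between-odd {n} n<x x<n′ =
      reps≢1 {v₁₃} {p = 0 , suc n} {q = 1 , n} (z≤n , ≤-refl , refl)
        (s≤s z≤n , n≤1+n n , sym (cong suc (odd-suc (suc (suc k))))) λ ()

v₁₂-terms : TermsAre v₁₂ 2
v₁₂-terms n = mk⇔ to from
  where
  to : ∃[ m ] v₁₂ m ≡ n → n ≡ 2 ⊎ PosOdd n
  to (0 , refl) = inj₂ (0 , refl)
  to (1 , refl) = inj₁ refl
  to (suc (suc k) , refl) = inj₂ (suc k , refl)
  from : n ≡ 2 ⊎ PosOdd n → ∃[ m ] v₁₂ m ≡ n
  from (inj₁ refl) = 1 , refl
  from (inj₂ (0 , refl)) = 0 , refl
  from (inj₂ (suc k , refl)) = suc (suc k) , refl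

v₁₃-terms : TermsAre v₁₃ 4
v₁₃-terms n = mk⇔ to from
  where
  to : ∃[ m ] v₁₃ m ≡ n → n ≡ 4 ⊎ PosOdd n
  to (0 , refl) = inj₂ (0 , refl)
  to (1 , refl) = inj₂ (1 , refl)
  to (2 , refl) = inj₁ refl
  to (suc (suc (suc k)) , refl) = inj₂ (suc (suc k) , refl)
  from : n ≡ 4 ⊎ PosOdd n → ∃[ m ] v₁₃ m ≡ n
  from (inj₁ refl) = 2 , refl
  from (inj₂ (0 , refl)) = 0 , refl
  from (inj₂ (1 , refl)) = 1 , refl
  from (inj₂ (suc (suc k) , refl)) = suc (suc (suc k)) , refl

theorem2p1 : ((∃[ f ] IsV 1 2 f) × (∀ f → IsV 1 2 f → TermsAre f 2))
           × ((∃[ f ] IsV 1 3 f) × (∀ f → IsV 1 3 f → TermsAre f 4))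
theorem2p1 = ((v₁₂ , v₁₂-IsV) , λ f v → TermsAre-cong (IsV-unique v v₁₂-IsV) v₁₂-terms)
           , ((v₁₃ , v₁₃-IsV) , λ f v → TermsAre-cong (IsV-unique v v₁₃-IsV) v₁₃-terms)
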